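{- Let $T$ be a tree and $r,r'$ rotor configurations on $T$ that differ at only finitely many vertices. Then for all $n$, $$|E_n(T,r)-E_n(T,r')|\le\sum_{v\in V_\rho}|r(v)-r'(v)|.$$
   Context: A tree $T$ is an infinite tree with all vertex degrees finite and a distinguished root $\rho$ of degree $1$; $V_\rho$ is its set of non-root vertices. For $v\in V_\rho$, $v^{(0)}$ is the parent and $v^{(1)},\dots,v^{(b(v))}$ the children of $v$, labelled so that the fixed cyclic order of neighbours of $v$ is $v^{(0)},v^{(1)},\dots,v^{(b(v))}$. A rotor configuration is a map $r$ on $V_\rho$ with $0\le r(v)\le b(v)$, meaning the rotor at $v$ points to $v^{(r(v))}$; the rotor at $\rho$ always points to its only child. Rotor walk: at each step the rotor at the particle's current vertex is advanced to the next neighbour in the cyclic order, and the particle moves there. Particles are started one after another at $\rho$: each performs rotor walk until it first returns to $\rho$, or else never returns (it escapes to infinity); the next particle starts with the rotors left by the previous ones. $E_n(T,r)$ is the number of the first $n$ particles that escape, starting from configuration $r$. -}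

module Defs where

open import Data.Nat using (ℕ; zero; suc; _<_; _≤_; _<ᵇ_; ∣_-_∣)
open import Data.List using (List; []; _∷_; map)
open import Data.Nat.ListAction using (sum)
open import Data.List.Properties using (≡-dec)
open import Data.List.Membership.Propositional using (_∉_)
open import Data.List.Relation.Unary.All using (All)
open import Data.List.Relation.Unary.Unique.Propositional using (Unique)
import Data.Nat.Properties as ℕP
open import Data.Maybe using (Maybe; nothing; just)
open import Data.Product using (Σ; ∃; _×_; _,_; proj₁; proj₂)
open import Data.Unit using (⊤)
open import Data.Bool using (if_then_else_)
open import Relation.Nullary using (¬_; yes; no)
open import Relation.Binary.PropositionalEquality using (_≡_; _≢_)
open import Function using (_∘_)

-- Non-root vertices are addressed by lists of child indices, read from the
-- vertex towards the unique child v₀ of the root ρ (address []).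
-- The child i (0-based, i < b v) of v has address (i ∷ v); in the paper's
-- labelling it is v^(i+1).  The root ρ itself is not an address.
Addr : Set
Addr = List ℕ

-- A tree (with root of degree 1, finite degrees) is given by the number of
-- children b(v) of each vertex; only addresses satisfying Valid are vertices.
Tree : Set
Tree = Addr → ℕ

Valid : Tree → Addr → Set
Valid b []      = ⊤
Valid b (i ∷ v) = Valid b v × i < b v

Infinite : Tree → Set
Infinite b = (l : List Addr) → ∃ λ v → Valid b v × v ∉ l

-- Rotor configurations: r(v) ∈ {0,…,b(v)}; 0 = parent, k ≥ 1 = child k.
Config : Set
Config = Addr → ℕ

IsRotorConfig : Tree → Config → Set
IsRotorConfig b r = ∀ v → Valid b v → r v ≤ b v

-- Particle position: nothing = ρ, just v = non-root vertex v.
Pos : Set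
Pos = Maybe Addr

State : Set
State = Pos × Config

update : Config → Addr → ℕ → Config
update r v k w with ≡-dec ℕP._≟_ w v
... | yes _ = k
... | no  _ = r w

parentOf : Addr → Pos
parentOf []      = nothing
parentOf (i ∷ v) = just v

target : Addr → ℕ → Pos
target v zero    = parentOf v
target v (suc i) = just (i ∷ v)

next : ℕ → ℕ → ℕ
next b k = if k <ᵇ b then suc k else 0

-- One step of rotor walk (the rotor at ρ always points to its only child).
step : Tree → State → State
step b (nothing , r) = just [] , r
step b (just v  , r) =
  let k = next (b v) (r v) in target v k , update r v k

iter : Tree → ℕ → State → State
iter b zero    s = s
iter b (suc n) s = step b (iter b n s)

walk : Tree → Config → ℕ → State
walk b r k = iter b k (nothing , r)

AtRoot : State → Set
AtRoot s = proj₁ s ≡ nothing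

Returns : Tree → Config → Config → Set
Returns b r r' = ∃ λ k → 1 ≤ k × AtRoot (walk b r k)
  × (∀ j → 1 ≤ j → j < k → ¬ AtRoot (walk b r j))
  × (∀ w → proj₂ (walk b r k) w ≡ r' w)

Escapes : Tree → Config → Config → Set
Escapes b r r' = (∀ k → 1 ≤ k → ¬ AtRoot (walk b r k))
  × (∀ w → ∃ λ K → ∀ k → K ≤ k → proj₂ (walk b r k) w ≡ r' w)

-- Run b r n e r' : after releasing n particles from configuration r,
-- exactly e of them escaped and the resulting configuration is r'.
-- (So e = E_n(T,r).)
data Run (b : Tree) (r : Config) : ℕ → ℕ → Config → Set where
  run-zero   : Run b r 0 0 r
  run-return : ∀ {n e r₁ r₂} → Run b r n e r₁ → Returns b r₁ r₂ → Run b r (suc n) e r₂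
  run-escape : ∀ {n e r₁ r₂} → Run b r n e r₁ → Escapes b r₁ r₂ → Run b r (suc n) (suc e) r₂

diffSum : Config → Config → List Addr → ℕ
diffSum r r' L = sum (map (λ v → ∣ r v - r' v ∣) L)

-- An excursion of a particle into the subtree of a vertex v splits into excursions into the
-- subtrees of the children, dealt out cyclically by the rotor at v.  Hence if, of the particles
-- entering the subtree of v, P are sent back to the parent, then child c received
-- P + [c < g v] - [c < r v] of them, where r and g are the rotors at the start and now.
-- Compare the runs from r and r' with the same number of entering particles, and let Δ v be
-- the sum of |r - r'| over the vertices of L below v.  If the r'-run sends at most Δ v fewer
-- particles back, it lets at most Δ v more escape.  Otherwise no child receives more particles
-- in the r'-run than in the r-run; induction on the depth of L below v, applied to a prefix of
-- each child's r-run, bounds the extra escapes by the sum of Δ over the children, which is at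
-- most Δ v.  Below L the two configurations agree and rotor walk is deterministic.  At the
-- root this bounds E_n(T,r') - E_n(T,r), and symmetrically E_n(T,r) - E_n(T,r').

module Submission where

open import Defs

open import Data.Nat
  using (ℕ; zero; suc; _+_; _*_; _∸_; _≤_; _<_; _≟_; _<?_; _≤?_; _<ᵇ_; z≤n; s≤s; s≤s⁻¹; z<s; ∣_-_∣)
open import Data.Nat.Properties
open import Data.Nat.Induction using (<-wellFounded)
open import Data.Nat.ListAction using (sum)
open import Algebra.Properties.CommutativeSemigroup +-commutativeSemigroup using (interchange; x∙yz≈y∙xz)
open import Data.Bool using (true; false; T)
open import Data.Empty using (⊥; ⊥-elim)
open import Data.List using (List; []; _∷_; length; map)
open import Data.List.Properties using (≡-dec; map-cong)
open import Data.List.Extrema.Nat using (argmax; f[xs]≤f[argmax])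
open import Data.List.Membership.Propositional using (_∈_; _∉_)
open import Data.List.Membership.DecPropositional (≡-dec _≟_) using (_∈?_)
open import Data.List.Relation.Unary.All as All using (All)
open import Data.List.Relation.Unary.Any using (here; there)
open import Data.List.Relation.Unary.Unique.Propositional using (Unique)
open import Data.Maybe using (just; nothing)
import Data.Maybe.Properties as Maybe
open import Data.Product using (Σ; ∃; _×_; _,_; proj₁; proj₂)
open import Data.Sum using (_⊎_; inj₁; inj₂; [_,_]′)
open import Data.Unit using (⊤; tt)
open import Induction.WellFounded using (Acc; acc)
open import Relation.Binary.Definitions using (tri<; tri≈; tri>)
open import Relation.Binary.PropositionalEquality
open import Relation.Nullary using (¬_; Dec; yes; no)
open import Relation.Unary using (Decidable)

data _≼_ (u : Addr) : Addr → Set where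
  ≼-refl  : u ≼ u
  ≼-child : ∀ {i w} → u ≼ w → u ≼ (i ∷ w)

≼-length : ∀ {u w} → u ≼ w → length u ≤ length w
≼-length ≼-refl      = ≤-refl
≼-length (≼-child p) = m≤n⇒m≤1+n (≼-length p)

child-⋠-parent : ∀ {i u} → ¬ (i ∷ u) ≼ u
child-⋠-parent p = 1+n≰n (≼-length p)

child-≼⇒≼ : ∀ {i u w} → (i ∷ u) ≼ w → u ≼ w
child-≼⇒≼ ≼-refl      = ≼-child ≼-refl
child-≼⇒≼ (≼-child p) = ≼-child (child-≼⇒≼ p)

child-≼⇒≢ : ∀ {i u w} → (i ∷ u) ≼ w → w ≢ u
child-≼⇒≢ p refl = child-⋠-parent p

child-≼-unique : ∀ {c c' v w} → (c ∷ v) ≼ w → (c' ∷ v) ≼ w → c ≡ c'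
child-≼-unique ≼-refl      ≼-refl      = refl
child-≼-unique ≼-refl      (≼-child q) = ⊥-elim (child-⋠-parent q)
child-≼-unique (≼-child p) ≼-refl      = ⊥-elim (child-⋠-parent p)
child-≼-unique (≼-child p) (≼-child q) = child-≼-unique p q

root-≼ : ∀ w → [] ≼ w
root-≼ []      = ≼-refl
root-≼ (_ ∷ w) = ≼-child (root-≼ w)

_≼?_ : ∀ u w → Dec (u ≼ w)
u ≼? [] with ≡-dec _≟_ u []
... | yes refl = yes ≼-refl
... | no u≢[]  = no λ { ≼-refl → u≢[] refl }
u ≼? (i ∷ w) with ≡-dec _≟_ u (i ∷ w) | u ≼? w
... | yes refl | _      = yes ≼-refl
... | no u≢iw  | yes p  = yes (≼-child p)
... | no u≢iw  | no u⋠w = no λ { ≼-refl → u≢iw refl ; (≼-child p) → u⋠w p }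

parent-∉-subtree : ∀ {u w} → u ≼ w → just w ≢ parentOf u
parent-∉-subtree {[]}    _   ()
parent-∉-subtree {_ ∷ _} u≼w refl = child-⋠-parent u≼w

data NextView (B k : ℕ) : ℕ → Set where
  wraps    : B ≤ k → NextView B k 0
  advances : k < B → NextView B k (suc k)

next-view : ∀ B k → NextView B k (next B k)
next-view B k with k <ᵇ B in k<ᵇB
... | true  = advances (<ᵇ⇒< k B (subst T (sym k<ᵇB) tt))
... | false = wraps (≮⇒≥ (λ k<B → subst T k<ᵇB (<⇒<ᵇ k<B)))

next-≢ : ∀ {B k} → 0 < B → next B k ≢ k
next-≢ {B} {k} 0<B with next B k | next-view B k
... | .0       | wraps B≤k = λ 0≡k → <⇒≱ 0<B (subst (B ≤_) (sym 0≡k) B≤k)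
... | .(suc k) | advances _ = 1+n≢n

update-≡ : ∀ {r v k} → update r v k v ≡ k
update-≡ {v = v} with ≡-dec _≟_ v v
... | yes _   = refl
... | no v≢v  = ⊥-elim (v≢v refl)

update-≢ : ∀ {r v k w} → w ≢ v → update r v k w ≡ r w
update-≢ {v = v} {w = w} w≢v with ≡-dec _≟_ w v
... | yes w≡v = ⊥-elim (w≢v w≡v)
... | no _    = refl

update-cong : ∀ {r r' v k k' w} → r w ≡ r' w → k ≡ k' → update r v k w ≡ update r' v k' w
update-cong {v = v} {w = w} rw≡ k≡k' with ≡-dec _≟_ w v
... | yes _ = k≡k'
... | no _  = rw≡

rotor-after-child : ∀ {i v} {g h : Config} →
                    (∀ w → ¬ (i ∷ v) ≼ w → h w ≡ update g v (suc i) w) → h v ≡ suc i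
rotor-after-child {i} {v} {g} frame = trans (frame v (child-⋠-parent {i})) (update-≡ {r = g} {v = v})

𝟙 : ∀ {P : Set} → Dec P → ℕ
𝟙 (yes _) = 1
𝟙 (no _)  = 0

𝟙-yes : ∀ {P : Set} (d : Dec P) → P → 𝟙 d ≡ 1
𝟙-yes (yes _) _  = refl
𝟙-yes (no ¬p) p  = ⊥-elim (¬p p)

𝟙-no : ∀ {P : Set} (d : Dec P) → ¬ P → 𝟙 d ≡ 0
𝟙-no (yes p) ¬p = ⊥-elim (¬p p)
𝟙-no (no _)  _  = refl

𝟙*-yes : ∀ {P : Set} (d : Dec P) n → P → 𝟙 d * n ≡ n
𝟙*-yes d n p = trans (cong (_* n) (𝟙-yes d p)) (*-identityˡ n)

𝟙≤1 : ∀ {P : Set} (d : Dec P) → 𝟙 d ≤ 1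
𝟙≤1 (yes _) = ≤-refl
𝟙≤1 (no _)  = z≤n

𝟙-<-suc : ∀ c i → 𝟙 (c <? suc i) ≡ 𝟙 (c ≟ i) + 𝟙 (c <? i)
𝟙-<-suc c i with c ≟ i
... | yes refl = trans (𝟙-yes (c <? suc c) ≤-refl) (cong suc (sym (𝟙-no (c <? c) (<-irrefl refl))))
... | no c≢i with c <? i
...   | yes c<i = 𝟙-yes (c <? suc i) (m<n⇒m<1+n c<i)
...   | no c≮i  = 𝟙-no (c <? suc i) (λ c<1+i → c≮i (≤∧≢⇒< (s≤s⁻¹ c<1+i) c≢i))

𝟙-<-∣-∣ : ∀ c k k' → 𝟙 (c <? k) ≤ 𝟙 (c <? k') + ∣ k - k' ∣
𝟙-<-∣-∣ c k k' with c <? k | c <? k'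
... | no _    | _      = z≤n
... | yes _   | yes _  = m≤m+n 1 _
... | yes c<k | no c≮k' = begin
    1               ≤⟨ m<n⇒0<n∸m k'<k ⟩
    k ∸ k'          ≡⟨ m≤n⇒∣n-m∣≡n∸m (<⇒≤ k'<k) ⟨
    ∣ k - k' ∣      ∎
  where
    open ≤-Reasoning
    k'<k = ≤-<-trans (≮⇒≥ c≮k') c<k

Σ< : ℕ → (ℕ → ℕ) → ℕ
Σ< zero    f = 0
Σ< (suc n) f = Σ< n f + f n

Σ<-zero : ∀ n → Σ< n (λ _ → 0) ≡ 0
Σ<-zero zero    = refl
Σ<-zero (suc n) = trans (+-identityʳ _) (Σ<-zero n)

Σ<-mono-≤ : ∀ n {f g} → (∀ c → c < n → f c ≤ g c) → Σ< n f ≤ Σ< n g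
Σ<-mono-≤ zero    _   = z≤n
Σ<-mono-≤ (suc n) f≤g = +-mono-≤ (Σ<-mono-≤ n (λ c c<n → f≤g c (m<n⇒m<1+n c<n))) (f≤g n ≤-refl)

Σ<-distrib-+ : ∀ n f g → Σ< n (λ c → f c + g c) ≡ Σ< n f + Σ< n g
Σ<-distrib-+ zero    f g = refl
Σ<-distrib-+ (suc n) f g =
  trans (cong (_+ (f n + g n)) (Σ<-distrib-+ n f g)) (interchange (Σ< n f) (Σ< n g) (f n) (g n))

Σ<-*-distribʳ : ∀ n f d → Σ< n (λ c → f c * d) ≡ Σ< n f * d
Σ<-*-distribʳ zero    f d = refl
Σ<-*-distribʳ (suc n) f d =
  trans (cong (_+ f n * d) (Σ<-*-distribʳ n f d)) (sym (*-distribʳ-+ d (Σ< n f) (f n)))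

module _ {P : ℕ → Set} (P? : Decidable P) where

  Σ<-𝟙-none : ∀ n → (∀ c → c < n → ¬ P c) → Σ< n (λ c → 𝟙 (P? c)) ≡ 0
  Σ<-𝟙-none zero    _    = refl
  Σ<-𝟙-none (suc n) none =
    cong₂ _+_ (Σ<-𝟙-none n (λ c c<n → none c (m<n⇒m<1+n c<n))) (𝟙-no (P? n) (none n ≤-refl))

  Σ<-𝟙-unique : (∀ {c c'} → P c → P c' → c ≡ c') → ∀ n → Σ< n (λ c → 𝟙 (P? c)) ≤ 1
  Σ<-𝟙-unique unique zero    = z≤n
  Σ<-𝟙-unique unique (suc n) with P? n
  ... | yes Pn = ≤-reflexive (cong (_+ 1) (Σ<-𝟙-none n (λ c c<n Pc → <-irrefl (unique Pc Pn) c<n)))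
  ... | no _   = ≤-trans (≤-reflexive (+-identityʳ _)) (Σ<-𝟙-unique unique n)

Σ<-𝟙-≟ : ∀ n {i} → i < n → Σ< n (λ c → 𝟙 (c ≟ i)) ≡ 1
Σ<-𝟙-≟ (suc n) {i} i<1+n with m<1+n⇒m<n∨m≡n i<1+n
... | inj₁ i<n  = cong₂ _+_ (Σ<-𝟙-≟ n i<n) (𝟙-no (n ≟ i) (λ n≡i → <-irrefl (sym n≡i) i<n))
... | inj₂ refl = cong₂ _+_ (Σ<-𝟙-none (_≟ n) n (λ c c<n c≡n → <-irrefl c≡n c<n)) (𝟙-yes (n ≟ n) refl)

least? : ∀ {P : ℕ → Set} → Decidable P → ∀ n →
         (∃ λ t → t < n × P t × ∀ j → j < t → ¬ P j) ⊎ (∀ t → t < n → ¬ P t)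
least? P? zero = inj₂ λ _ ()
least? P? (suc n) with least? P? n
... | inj₁ (t , t<n , Pt , earliest) = inj₁ (t , m<n⇒m<1+n t<n , Pt , earliest)
... | inj₂ none with P? n
...   | yes Pn  = inj₁ (n , ≤-refl , Pn , none)
...   | no ¬Pn  = inj₂ λ t t<1+n → [ none t , (λ { refl → ¬Pn }) ]′ (m<1+n⇒m<n∨m≡n t<1+n)

swap-≤ : ∀ {P e P' e' D} → P + e ≡ P' + e' → P ≤ P' + D → e' ≤ e + D
swap-≤ {P} {e} {P'} {e'} {D} split P≤P'+D = +-cancelˡ-≤ P' e' (e + D) (begin
  P' + e'      ≡⟨ split ⟨
  P + e        ≤⟨ +-monoˡ-≤ e P≤P'+D ⟩
  P' + D + e   ≡⟨ +-assoc P' D e ⟩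
  P' + (D + e) ≡⟨ cong (P' +_) (+-comm D e) ⟩
  P' + (e + D) ∎)
  where open ≤-Reasoning

balance-≤ : ∀ {a a' x x' y y' P P' D} → a + x ≡ P + y → a' + x' ≡ P' + y' → y' ≤ 1 →
            x ≤ x' + D → P' + D < P → a' ≤ a
balance-≤ {a} {a'} {x} {x'} {y} {y'} {P} {P'} {D} bal bal' y'≤1 x≤ P'+D<P = +-cancelʳ-≤ (x' + D) a' a (begin
  a' + (x' + D)  ≡⟨ +-assoc a' x' D ⟨
  a' + x' + D    ≡⟨ cong (_+ D) bal' ⟩
  P' + y' + D    ≤⟨ +-monoˡ-≤ D (+-monoʳ-≤ P' y'≤1) ⟩
  P' + 1 + D     ≡⟨ cong (_+ D) (+-comm P' 1) ⟩
  suc (P' + D)   ≤⟨ P'+D<P ⟩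
  P              ≤⟨ m≤m+n P y ⟩
  P + y          ≡⟨ bal ⟨
  a + x          ≤⟨ +-monoʳ-≤ a x≤ ⟩
  a + (x' + D)   ∎)
  where open ≤-Reasoning

m≤n+o⇒n≤m+o⇒∣m-n∣≤o : ∀ {m n o} → m ≤ n + o → n ≤ m + o → ∣ m - n ∣ ≤ o
m≤n+o⇒n≤m+o⇒∣m-n∣≤o {m} {n} {o} m≤n+o n≤m+o with ≤-total m n
... | inj₁ m≤n = subst (_≤ o) (sym (m≤n⇒∣m-n∣≡n∸m m≤n)) (m≤n+o⇒m∸n≤o n m n≤m+o)
... | inj₂ n≤m = subst (_≤ o) (sym (m≤n⇒∣n-m∣≡n∸m n≤m)) (m≤n+o⇒m∸n≤o m n m≤n+o)

subtreeDiff : Config → Config → List Addr → Addr → ℕ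
subtreeDiff r r' []      v = 0
subtreeDiff r r' (w ∷ L) v = 𝟙 (v ≼? w) * ∣ r w - r' w ∣ + subtreeDiff r r' L v

subtreeDiff-root : ∀ r r' L → subtreeDiff r r' L [] ≡ diffSum r r' L
subtreeDiff-root r r' []      = refl
subtreeDiff-root r r' (w ∷ L) =
  cong₂ _+_ (𝟙*-yes ([] ≼? w) _ (root-≼ w)) (subtreeDiff-root r r' L)

subtreeDiff-∈ : ∀ r r' L {v} → v ∈ L → ∣ r v - r' v ∣ ≤ subtreeDiff r r' L v
subtreeDiff-∈ r r' (w ∷ L) (here refl) =
  ≤-trans (≤-reflexive (sym (𝟙*-yes (w ≼? w) _ ≼-refl))) (m≤m+n _ _)
subtreeDiff-∈ r r' (w ∷ L) (there v∈L) = ≤-trans (subtreeDiff-∈ r r' L v∈L) (m≤n+m _ _)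

Σ<-𝟙-children : ∀ v w n → Σ< n (λ c → 𝟙 ((c ∷ v) ≼? w)) ≤ 𝟙 (v ≼? w)
Σ<-𝟙-children v w n with v ≼? w
... | yes _  = Σ<-𝟙-unique (λ c → (c ∷ v) ≼? w) child-≼-unique n
... | no v⋠w =
  ≤-reflexive (Σ<-𝟙-none (λ c → (c ∷ v) ≼? w) n (λ c _ cv≼w → v⋠w (child-≼⇒≼ cv≼w)))

subtreeDiff-children : ∀ r r' L v n → Σ< n (λ c → subtreeDiff r r' L (c ∷ v)) ≤ subtreeDiff r r' L v
subtreeDiff-children r r' []      v n = ≤-reflexive (Σ<-zero n)
subtreeDiff-children r r' (w ∷ L) v n = begin
    Σ< n (λ c → 𝟙 ((c ∷ v) ≼? w) * δ + subtreeDiff r r' L (c ∷ v))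
  ≡⟨ Σ<-distrib-+ n _ _ ⟩
    Σ< n (λ c → 𝟙 ((c ∷ v) ≼? w) * δ) + Σ< n (λ c → subtreeDiff r r' L (c ∷ v))
  ≡⟨ cong (_+ _) (Σ<-*-distribʳ n _ δ) ⟩
    Σ< n (λ c → 𝟙 ((c ∷ v) ≼? w)) * δ + Σ< n (λ c → subtreeDiff r r' L (c ∷ v))
  ≤⟨ +-mono-≤ (*-monoˡ-≤ δ (Σ<-𝟙-children v w n)) (subtreeDiff-children r r' L v n) ⟩
    𝟙 (v ≼? w) * δ + subtreeDiff r r' L v
  ∎
  where
    open ≤-Reasoning
    δ = ∣ r w - r' w ∣

diffSum-comm : ∀ r r' L → diffSum r r' L ≡ diffSum r' r L
diffSum-comm r r' L = cong sum (map-cong (λ v → ∣-∣-comm (r v) (r' v)) L)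

WithinDepth : List Addr → ℕ → Addr → Set
WithinDepth L h v = ∀ w → w ∈ L → v ≼ w → length w < length v + h

within-child : ∀ {L h v} c → WithinDepth L (suc h) v → WithinDepth L h (c ∷ v)
within-child {h = h} {v} c within w w∈L cv≼w =
  subst (length w <_) (+-suc (length v) h) (within w w∈L (child-≼⇒≼ cv≼w))

module _ (b : Tree) where

  turn : Config → Addr → ℕ
  turn g w = next (b w) (g w)

  walkFrom : Addr → Config → ℕ → State
  walkFrom v g k = iter b k (just v , g)

  position : Addr → Config → ℕ → Pos
  position v g k = proj₁ (walkFrom v g k)

  rotors : Addr → Config → ℕ → Config
  rotors v g k = proj₂ (walkFrom v g k)

  iter-suc : ∀ k s → iter b (suc k) s ≡ iter b k (step b s)
  iter-suc zero    s = refl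
  iter-suc (suc k) s = cong (step b) (iter-suc k s)

  iter-+ : ∀ k j s → iter b (k + j) s ≡ iter b k (iter b j s)
  iter-+ zero    j s = refl
  iter-+ (suc k) j s = cong (step b) (iter-+ k j s)

  step-from : ∀ {s w} → proj₁ s ≡ just w →
              step b s ≡ (target w (turn (proj₂ s) w) , update (proj₂ s) w (turn (proj₂ s) w))
  step-from {_ , _} refl = refl

  restart : ∀ {u g v d} → position u g d ≡ just v → ∀ j → walkFrom u g (j + d) ≡ walkFrom v (rotors u g d) j
  restart {u} {g} {d = d} at-v j =
    trans (iter-+ j d (just u , g)) (cong (λ p → iter b j (p , rotors u g d)) at-v)

  StaysBelow : Addr → Config → ℕ → Set
  StaysBelow u g t = ∀ j → j < t → position u g j ≢ parentOf u

  staysBelow-mono : ∀ {u g t t'} → t ≤ t' → StaysBelow u g t' → StaysBelow u g t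
  staysBelow-mono t≤t' stays j j<t = stays j (<-≤-trans j<t t≤t')

  InSubtree : Addr → Pos → Set
  InSubtree u p = ∃ λ w → p ≡ just w × u ≼ w

  target-inSubtree : ∀ {u w} n → u ≼ w → target w n ≢ parentOf u → InSubtree u (target w n)
  target-inSubtree (suc i)          u≼w           _      = _ , refl , ≼-child u≼w
  target-inSubtree zero             ≼-refl        up≢up  = ⊥-elim (up≢up refl)
  target-inSubtree {w = _ ∷ w} zero (≼-child u≼w) _      = w , refl , u≼w

  walk-confined : ∀ {u g} t → StaysBelow u g (suc t) → InSubtree u (position u g t)
  walk-confined zero _ = _ , refl , ≼-refl
  walk-confined {u} {g} (suc t) stays with walk-confined t (staysBelow-mono (n≤1+n _) stays)
  ... | w , at-w , u≼w =
    subst (InSubtree u) (sym moves)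
          (target-inSubtree (turn (rotors u g t) w) u≼w (λ up → stays (suc t) ≤-refl (trans moves up)))
    where
      moves : position u g (suc t) ≡ target w (turn (rotors u g t) w)
      moves = cong proj₁ (step-from at-w)

  walk-frame : ∀ {u g} t → StaysBelow u g t → ∀ w → ¬ u ≼ w → rotors u g t w ≡ g w
  walk-frame zero _ _ _ = refl
  walk-frame {u} {g} (suc t) stays w u⋠w with walk-confined t stays
  ... | x , at-x , u≼x = begin
      rotors u g (suc t) w
    ≡⟨ cong (λ s → proj₂ s w) (step-from at-x) ⟩
      update (rotors u g t) x (turn (rotors u g t) x) w
    ≡⟨ update-≢ {r = rotors u g t} {v = x} (λ { refl → u⋠w u≼x }) ⟩
      rotors u g t w
    ≡⟨ walk-frame t (staysBelow-mono (n≤1+n _) stays) w u⋠w ⟩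
      g w
    ∎
    where open ≡-Reasoning

  ValidPos : Pos → Set
  ValidPos nothing  = ⊤
  ValidPos (just w) = Valid b w

  parent-valid : ∀ w → Valid b w → ValidPos (parentOf w)
  parent-valid []      _        = tt
  parent-valid (_ ∷ _) (valid , _) = valid

  step-valid : ∀ s → ValidPos (proj₁ s) → ValidPos (proj₁ (step b s))
  step-valid (nothing , _) _ = tt
  step-valid (just w , g) valid with next (b w) (g w) | next-view (b w) (g w)
  ... | .0       | wraps _      = parent-valid w valid
  ... | .(suc _) | advances i<b = valid , i<b

  position-valid : ∀ {u} g k → Valid b u → ValidPos (position u g k)
  position-valid g zero    valid = valid
  position-valid {u} g (suc k) valid = step-valid (walkFrom u g k) (position-valid g k valid)

  record Return (v : Addr) (g f : Config) : Set where
    field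
      steps   : ℕ
      arrives : position v g steps ≡ parentOf v
      first   : StaysBelow v g steps
      leaves  : ∀ w → rotors v g steps w ≡ f w

  record Escape (v : Addr) (g f : Config) : Set where
    field
      avoids  : ∀ k → position v g k ≢ parentOf v
      settles : ∀ w → ∃ λ K → ∀ k → K ≤ k → rotors v g k w ≡ f w

  open Return
  open Escape

  return-frame : ∀ {u g h} → Return u g h → ∀ w → ¬ u ≼ w → h w ≡ g w
  return-frame ex w u⋠w = trans (sym (leaves ex w)) (walk-frame (steps ex) (first ex) w u⋠w)

  escape-frame : ∀ {u g h} → Escape u g h → ∀ w → ¬ u ≼ w → h w ≡ g w
  escape-frame ex w u⋠w with settles ex w
  ... | K , settled = trans (sym (settled K ≤-refl)) (walk-frame K (λ j _ → avoids ex j) w u⋠w)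

  return-resume : ∀ {v g h f} d → (∀ j → walkFrom v g (j + d) ≡ walkFrom v h j) →
                  (ex : Return v g f) → d ≤ steps ex → Σ (Return v h f) λ ex' → steps ex' + d ≡ steps ex
  return-resume {v} {g} {h} {f} d shift ex d≤K = rest , K∸d+d≡K
    where
      K∸d+d≡K = m∸n+n≡m d≤K
      at-end : walkFrom v h (steps ex ∸ d) ≡ walkFrom v g (steps ex)
      at-end = trans (sym (shift (steps ex ∸ d))) (cong (walkFrom v g) K∸d+d≡K)
      rest : Return v h f
      rest = record
        { steps   = steps ex ∸ d
        ; arrives = trans (cong proj₁ at-end) (arrives ex)
        ; first   = λ j j<K∸d → subst (_≢ parentOf v) (cong proj₁ (shift j))
                      (first ex (j + d) (subst (j + d <_) K∸d+d≡K (+-monoˡ-< d j<K∸d)))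
        ; leaves  = λ w → trans (cong (λ s → proj₂ s w) at-end) (leaves ex w)
        }

  escape-resume : ∀ {v g h f} d → (∀ j → walkFrom v g (j + d) ≡ walkFrom v h j) → Escape v g f → Escape v h f
  escape-resume {v} d shift ex = record
    { avoids  = λ j → subst (_≢ parentOf v) (cong proj₁ (shift j)) (avoids ex (j + d))
    ; settles = λ w → let K , settled = settles ex w in
        K , λ k K≤k → trans (cong (λ s → proj₂ s w) (sym (shift k)))
                            (settled (k + d) (≤-trans K≤k (m≤m+n k d)))
    }

  -- Each later visit to v would advance the rotor at v, which has settled.
  escape-revisits-finitely : ∀ {v g f} → 0 < b v → Escape v g f →
                             ∃ λ K → ∀ k → K ≤ k → position v g k ≢ just v
  escape-revisits-finitely {v} {g} {f} 0<b ex with settles ex v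
  ... | K , settled = K , λ k K≤k at-v → next-≢ 0<b (begin
      next (b v) (f v)                  ≡⟨ cong (next (b v)) (settled k K≤k) ⟨
      turn (rotors v g k) v             ≡⟨ update-≡ {r = rotors v g k} {v = v} ⟨
      update (rotors v g k) v (turn (rotors v g k) v) v ≡⟨ cong (λ s → proj₂ s v) (step-from at-v) ⟨
      rotors v g (suc k) v              ≡⟨ settled (suc k) (m≤n⇒m≤1+n K≤k) ⟩
      f v                               ∎)
    where open ≡-Reasoning

  return-viaParent : ∀ {v g f} → turn g v ≡ 0 → Return v g f → ∀ w → update g v 0 w ≡ f w
  return-viaParent _ record { steps = zero ; arrives = arrived } _ = ⊥-elim (parent-∉-subtree ≼-refl arrived)
  return-viaParent {v} {g} to-parent record { steps = suc zero ; leaves = left } w =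
    trans (cong (λ n → update g v n w) (sym to-parent)) (left w)
  return-viaParent {v} to-parent record { steps = suc (suc _) ; first = fst } _ =
    ⊥-elim (fst 1 (s≤s (s≤s z≤n)) (cong (target v) to-parent))

  escape-notViaParent : ∀ {v g f} → turn g v ≡ 0 → ¬ Escape v g f
  escape-notViaParent {v} to-parent ex = avoids ex 1 (cong (target v) to-parent)

  module ChildExcursion {v g i} (to-child : turn g v ≡ suc i) where

    g₁ : Config
    g₁ = update g v (suc i)

    via-child : ∀ k → walkFrom v g (suc k) ≡ walkFrom (i ∷ v) g₁ k
    via-child k = trans (iter-suc k (just v , g)) (cong (λ n → iter b k (target v n , update g v n)) to-child)

    Visits : ℕ → Set
    Visits t = position (i ∷ v) g₁ t ≡ just v

    visits? : Decidable Visits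
    visits? t = Maybe.≡-dec (≡-dec _≟_) _ _

    module _ {t} (lands : Visits t) (earliest : ∀ j → j < t → ¬ Visits j) where

      childReturn : Return (i ∷ v) g₁ (rotors v g (suc t))
      childReturn = record
        { steps = t ; arrives = lands ; first = earliest
        ; leaves = λ w → cong (λ s → proj₂ s w) (sym (via-child t)) }

      resumes : ∀ j → walkFrom v g (j + suc t) ≡ walkFrom v (rotors v g (suc t)) j
      resumes = restart (trans (cong proj₁ (via-child t)) lands)

    -- A walk that enters the subtree of the child can only leave it through v.
    child-reaches-v : ∀ K → position v g (suc K) ≡ parentOf v →
                      ∃ λ t → t < K × Visits t × ∀ j → j < t → ¬ Visits j
    child-reaches-v K arrived with least? visits? K
    ... | inj₁ found = found
    ... | inj₂ none  = ⊥-elim (outside (walk-confined K stays))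
      where
        at-parent : position (i ∷ v) g₁ K ≡ parentOf v
        at-parent = trans (cong proj₁ (sym (via-child K))) arrived
        stays : StaysBelow (i ∷ v) g₁ (suc K)
        stays j j<1+K with m<1+n⇒m<n∨m≡n j<1+K
        ... | inj₁ j<K  = none j j<K
        ... | inj₂ refl = λ lands → parent-∉-subtree ≼-refl (trans (sym lands) at-parent)
        outside : ¬ InSubtree (i ∷ v) (position (i ∷ v) g₁ K)
        outside (w , at-w , iv≼w) = parent-∉-subtree (child-≼⇒≼ iv≼w) (trans (sym at-w) at-parent)

    return-viaChild : ∀ {f} (ex : Return v g f) →
                      ∃ λ h → Return (i ∷ v) g₁ h × Σ (Return v h f) λ rest → steps rest < steps ex
    return-viaChild record { steps = zero ; arrives = arrived } = ⊥-elim (parent-∉-subtree ≼-refl arrived)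
    return-viaChild ex@record { steps = suc K ; arrives = arrived } with child-reaches-v K arrived
    ... | t , t<K , lands , earliest with return-resume (suc t) (resumes lands earliest) ex (s≤s (<⇒≤ t<K))
    ...   | rest , total = _ , childReturn lands earliest , rest , subst (steps rest <_) total (m<m+n _ z<s)

    escape-viaChild : ∀ {f} → 0 < b v → Escape v g f →
                      (∃ λ h → Return (i ∷ v) g₁ h × Escape v h f) ⊎ Escape (i ∷ v) g₁ f
    escape-viaChild 0<b ex with escape-revisits-finitely 0<b ex
    ... | K , late with least? visits? K
    ...   | inj₁ (t , _ , lands , earliest) =
            inj₁ (_ , childReturn lands earliest , escape-resume (suc t) (resumes lands earliest) ex)
    ...   | inj₂ none = inj₂ record
            { avoids  = never
            ; settles = λ w → let K' , settled = settles ex w in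
                K' , λ k K'≤k → trans (cong (λ s → proj₂ s w) (sym (via-child k)))
                                      (settled (suc k) (m≤n⇒m≤1+n K'≤k))
            }
      where
        never : ∀ t → ¬ Visits t
        never t with t <? K
        ... | yes t<K = none t t<K
        ... | no t≮K  = λ lands →
          late (suc t) (m≤n⇒m≤1+n (≮⇒≥ t≮K)) (trans (cong proj₁ (via-child t)) lands)

  Agree : Addr → Config → Config → Set
  Agree v f g = ∀ w → v ≼ w → f w ≡ g w

  -- Particles enter the subtree of v one at a time from its parent; between two entries the
  -- rotors outside the subtree may have been changed by the rest of the walk.
  data SubtreeRun (v : Addr) (r : Config) : ℕ → ℕ → Config → Set where
    sub-zero   : SubtreeRun v r 0 0 r
    sub-return : ∀ {m e f g h} → SubtreeRun v r m e f → Agree v f g → Return v g h →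
                 SubtreeRun v r (suc m) e h
    sub-escape : ∀ {m e f g h} → SubtreeRun v r m e f → Agree v f g → Escape v g h →
                 SubtreeRun v r (suc m) (suc e) h

  -- P particles went back to the parent and E escaped.  The rotor at v serves child c (rotor
  -- value c + 1) once in each of its P full turns, corrected by where it started (r v) and where
  -- it stands now (g v).
  record ChildRuns (v : Addr) (r g : Config) (P E : ℕ) : Set where
    field
      entries : ℕ → ℕ
      escapes : ℕ → ℕ
      run     : ∀ c → c < b v → ∃ λ f → SubtreeRun (c ∷ v) r (entries c) (escapes c) f × Agree (c ∷ v) f g
      balance : ∀ c → c < b v → entries c + 𝟙 (c <? r v) ≡ P + 𝟙 (c <? g v)
      total   : Σ< (b v) escapes ≡ E

  open ChildRuns

  childRuns-init : ∀ v r → ChildRuns v r r 0 0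
  childRuns-init v r = record
    { entries = λ _ → 0 ; escapes = λ _ → 0 ; run = λ _ _ → r , sub-zero , λ _ _ → refl
    ; balance = λ _ _ → refl ; total = Σ<-zero (b v) }

  childRuns-agree : ∀ {v r f g P E} → ChildRuns v r f P E → Agree v f g → ChildRuns v r g P E
  childRuns-agree {v} {r} {P = P} d f≈g = record
    { entries = entries d
    ; escapes = escapes d
    ; run     = λ c c<b → let f' , R , f'≈f = run d c c<b in
                  f' , R , λ w cv≼w → trans (f'≈f w cv≼w) (f≈g w (child-≼⇒≼ cv≼w))
    ; balance = λ c c<b →
        subst (λ k → entries d c + 𝟙 (c <? r v) ≡ P + 𝟙 (c <? k)) (f≈g v ≼-refl) (balance d c c<b)
    ; total   = total d
    }

  childRuns-toParent : ∀ {v r g P E} → ChildRuns v r g P E → b v ≤ g v → ChildRuns v r (update g v 0) (suc P) E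
  childRuns-toParent {v} {r} {g} {P} d b≤g = record
    { entries = entries d
    ; escapes = escapes d
    ; run     = λ c c<b → let f , R , f≈g = run d c c<b in
                  f , R , λ w cv≼w → trans (f≈g w cv≼w) (sym (update-≢ (child-≼⇒≢ cv≼w)))
    ; balance = λ c c<b → begin
        entries d c + 𝟙 (c <? r v)        ≡⟨ balance d c c<b ⟩
        P + 𝟙 (c <? g v)                  ≡⟨ cong (P +_) (𝟙-yes (c <? g v) (<-≤-trans c<b b≤g)) ⟩
        P + 1                             ≡⟨ +-comm P 1 ⟩
        suc P                             ≡⟨ +-identityʳ (suc P) ⟨
        suc P + 0                         ≡⟨ cong (suc P +_) (𝟙-no (c <? 0) λ ()) ⟨
        suc P + 𝟙 (c <? 0)                ≡⟨ cong (λ k → suc P + 𝟙 (c <? k)) (update-≡ {r = g} {v = v}) ⟨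
        suc P + 𝟙 (c <? update g v 0 v)   ∎
    ; total   = total d
    }
    where open ≡-Reasoning

  module _ {v r g P E} (d : ChildRuns v r g P E) (i<b : g v < b v) where

    private
      i  = g v
      g₁ = update g v (suc i)

      Frame : Config → Set
      Frame h = ∀ w → ¬ (i ∷ v) ≼ w → h w ≡ g₁ w

      balance' : ∀ {h} → Frame h → ∀ c → c < b v →
                 (𝟙 (c ≟ i) + entries d c) + 𝟙 (c <? r v) ≡ P + 𝟙 (c <? h v)
      balance' {h} frame c c<b = begin
        (𝟙 (c ≟ i) + entries d c) + 𝟙 (c <? r v)   ≡⟨ +-assoc (𝟙 (c ≟ i)) _ _ ⟩
        𝟙 (c ≟ i) + (entries d c + 𝟙 (c <? r v))   ≡⟨ cong (𝟙 (c ≟ i) +_) (balance d c c<b) ⟩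
        𝟙 (c ≟ i) + (P + 𝟙 (c <? i))               ≡⟨ x∙yz≈y∙xz (𝟙 (c ≟ i)) P _ ⟩
        P + (𝟙 (c ≟ i) + 𝟙 (c <? i))               ≡⟨ cong (P +_) (𝟙-<-suc c i) ⟨
        P + 𝟙 (c <? suc i)                         ≡⟨ cong (λ k → P + 𝟙 (c <? k)) (rotor-after-child {g = g} frame) ⟨
        P + 𝟙 (c <? h v)                           ∎
        where open ≡-Reasoning

      agree-child : ∀ {f} → Agree (i ∷ v) f g → Agree (i ∷ v) f g₁
      agree-child f≈g w iv≼w = trans (f≈g w iv≼w) (sym (update-≢ (child-≼⇒≢ iv≼w)))

      other-run : ∀ {h} → Frame h → ∀ c → c ≢ i → c < b v →
                  ∃ λ f → SubtreeRun (c ∷ v) r (entries d c) (escapes d c) f × Agree (c ∷ v) f h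
      other-run frame c c≢i c<b = let f , R , f≈g = run d c c<b in
        f , R , λ w cv≼w → trans (f≈g w cv≼w) (trans (sym (update-≢ (child-≼⇒≢ cv≼w)))
                                 (sym (frame w (λ iv≼w → c≢i (child-≼-unique cv≼w iv≼w)))))

    childRuns-childReturn : ∀ {h} → Return (i ∷ v) g₁ h → ChildRuns v r h P E
    childRuns-childReturn {h} ex = record
      { entries = λ c → 𝟙 (c ≟ i) + entries d c
      ; escapes = escapes d
      ; run     = run'
      ; balance = balance' (return-frame ex)
      ; total   = total d
      }
      where
        run' : ∀ c → c < b v →
               ∃ λ f → SubtreeRun (c ∷ v) r (𝟙 (c ≟ i) + entries d c) (escapes d c) f × Agree (c ∷ v) f h
        run' c c<b with c ≟ i
        ... | yes refl = let _ , R , f≈g = run d c c<b in h , sub-return R (agree-child f≈g) ex , λ _ _ → refl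
        ... | no c≢i   = other-run (return-frame ex) c c≢i c<b

    childRuns-childEscape : ∀ {h} → Escape (i ∷ v) g₁ h → ChildRuns v r h P (suc E)
    childRuns-childEscape {h} ex = record
      { entries = λ c → 𝟙 (c ≟ i) + entries d c
      ; escapes = λ c → 𝟙 (c ≟ i) + escapes d c
      ; run     = run'
      ; balance = balance' (escape-frame ex)
      ; total   = trans (Σ<-distrib-+ (b v) _ _) (cong₂ _+_ (Σ<-𝟙-≟ (b v) i<b) (total d))
      }
      where
        run' : ∀ c → c < b v → ∃ λ f →
               SubtreeRun (c ∷ v) r (𝟙 (c ≟ i) + entries d c) (𝟙 (c ≟ i) + escapes d c) f × Agree (c ∷ v) f h
        run' c c<b with c ≟ i
        ... | yes refl = let _ , R , f≈g = run d c c<b in h , sub-escape R (agree-child f≈g) ex , λ _ _ → refl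
        ... | no c≢i   = other-run (escape-frame ex) c c≢i c<b

  childRuns-return : ∀ {v r g f P E} (ex : Return v g f) → Acc _<_ (steps ex) →
                     ChildRuns v r g P E → ChildRuns v r f (suc P) E
  childRuns-return {v} {g = g} ex (acc smaller) d with turn g v in to | next-view (b v) (g v)
  ... | .0       | wraps b≤g   = childRuns-agree (childRuns-toParent d b≤g) (λ w _ → return-viaParent to ex w)
  ... | .(suc _) | advances g<b with ChildExcursion.return-viaChild to ex
  ...   | _ , child , rest , shorter = childRuns-return rest (smaller shorter) (childRuns-childReturn d g<b child)

  childRuns-escape : ∀ {v r g f P E} → Escape v g f → Acc _<_ (b v ∸ g v) →
                     ChildRuns v r g P E → ChildRuns v r f P (suc E)
  childRuns-escape {v} {g = g} ex (acc smaller) d with turn g v in to | next-view (b v) (g v)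
  ... | .0       | wraps _      = ⊥-elim (escape-notViaParent to ex)
  ... | .(suc _) | advances g<b with ChildExcursion.escape-viaChild to (≤-<-trans z≤n g<b) ex
  ...   | inj₂ child = childRuns-childEscape d g<b child
  ...   | inj₁ (h , child , rest) = childRuns-escape rest (smaller fewer-left) (childRuns-childReturn d g<b child)
    where
      fewer-left : b v ∸ h v < b v ∸ g v
      fewer-left = subst (λ k → b v ∸ k < b v ∸ g v) (sym (rotor-after-child {g = g} (return-frame child)))
                         (∸-monoʳ-< (n<1+n (g v)) g<b)

  subtreeRun⇒childRuns : ∀ {v r m e f} → SubtreeRun v r m e f → ∃ λ P → ChildRuns v r f P e × m ≡ P + e
  subtreeRun⇒childRuns {v} {r} sub-zero = 0 , childRuns-init v r , refl
  subtreeRun⇒childRuns (sub-return R f≈g ex) with subtreeRun⇒childRuns R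
  ... | P , d , m≡ = suc P , childRuns-return ex (<-wellFounded _) (childRuns-agree d f≈g) , cong suc m≡
  subtreeRun⇒childRuns (sub-escape R f≈g ex) with subtreeRun⇒childRuns R
  ... | P , d , m≡ =
    P , childRuns-escape ex (<-wellFounded _) (childRuns-agree d f≈g) , trans (cong suc m≡) (sym (+-suc P _))

  AgreeOnValid : Addr → Config → Config → Set
  AgreeOnValid v g g' = ∀ w → Valid b w → v ≼ w → g w ≡ g' w

  agreeOnValid-sym : ∀ {v g g'} → AgreeOnValid v g g' → AgreeOnValid v g' g
  agreeOnValid-sym g≈g' w valid v≼w = sym (g≈g' w valid v≼w)

  agreeOnValid-bridge : ∀ {v f f' g g'} → Agree v f g → AgreeOnValid v f f' → Agree v f' g' → AgreeOnValid v g g'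
  agreeOnValid-bridge f≈g f≈f' f'≈g' w valid v≼w =
    trans (sym (f≈g w v≼w)) (trans (f≈f' w valid v≼w) (f'≈g' w v≼w))

  module _ {v} (v-valid : Valid b v) where

    walks-agree : ∀ {g g'} → AgreeOnValid v g g' → ∀ k → StaysBelow v g k →
                  position v g k ≡ position v g' k × AgreeOnValid v (rotors v g k) (rotors v g' k)
    walks-agree g≈g' zero _ = refl , g≈g'
    walks-agree {g} {g'} g≈g' (suc k) stays
      with walks-agree g≈g' k (staysBelow-mono (n≤1+n k) stays) | walk-confined k stays
    ... | same-position , same-rotors | w , at-w , v≼w =
          trans (cong proj₁ moves) (trans (cong (target w) same-turn) (sym (cong proj₁ moves'))) ,
          λ u valid v≼u → trans (cong (λ s → proj₂ s u) moves)
                            (trans (update-cong {r = rotors v g k} {rotors v g' k} {w} {w = u}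
                                                (same-rotors u valid v≼u) same-turn)
                                   (sym (cong (λ s → proj₂ s u) moves')))
      where
        w-valid : Valid b w
        w-valid = subst ValidPos at-w (position-valid g k v-valid)
        same-turn : turn (rotors v g k) w ≡ turn (rotors v g' k) w
        same-turn = cong (next (b w)) (same-rotors w w-valid v≼w)
        moves  = step-from {walkFrom v g k} at-w
        moves' = step-from {walkFrom v g' k} (trans (sym same-position) at-w)

    return-not-earlier : ∀ {g g' f f'} → AgreeOnValid v g g' → (ex : Return v g f) (ex' : Return v g' f') →
                         ¬ steps ex < steps ex'
    return-not-earlier g≈g' ex ex' earlier =
      first ex' (steps ex) earlier (trans (sym (proj₁ (walks-agree g≈g' (steps ex) (first ex)))) (arrives ex))

    return-deterministic : ∀ {g g' f f'} → AgreeOnValid v g g' →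
                           Return v g f → Return v g' f' → AgreeOnValid v f f'
    return-deterministic g≈g' ex ex' with <-cmp (steps ex) (steps ex')
    ... | tri< earlier _ _ = ⊥-elim (return-not-earlier g≈g' ex ex' earlier)
    ... | tri> _ _ later   = ⊥-elim (return-not-earlier (agreeOnValid-sym g≈g') ex' ex later)
    ... | tri≈ _ same _    = λ w valid v≼w →
          trans (sym (leaves ex w))
                (trans (proj₂ (walks-agree g≈g' (steps ex) (first ex)) w valid v≼w)
                       (trans (cong (λ k → rotors v _ k w) same) (leaves ex' w)))

    return-escape-exclusive : ∀ {g g' f f'} → AgreeOnValid v g g' → Return v g f → ¬ Escape v g' f'
    return-escape-exclusive g≈g' ex esc =
      avoids esc (steps ex) (trans (sym (proj₁ (walks-agree g≈g' (steps ex) (first ex)))) (arrives ex))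

    escape-deterministic : ∀ {g g' f f'} → AgreeOnValid v g g' →
                           Escape v g f → Escape v g' f' → AgreeOnValid v f f'
    escape-deterministic {g} {g'} {f} {f'} g≈g' esc esc' w valid v≼w with settles esc w | settles esc' w
    ... | K , settled | K' , settled' = begin
        f w                    ≡⟨ settled (K + K') (m≤m+n K K') ⟨
        rotors v g (K + K') w  ≡⟨ proj₂ (walks-agree g≈g' (K + K') (λ j _ → avoids esc j)) w valid v≼w ⟩
        rotors v g' (K + K') w ≡⟨ settled' (K + K') (m≤n+m K' K) ⟩
        f' w                   ∎
      where open ≡-Reasoning

    subtreeRun-deterministic : ∀ {r r' m e e' f f'} → AgreeOnValid v r r' →
                               SubtreeRun v r m e f → SubtreeRun v r' m e' f' → e ≡ e' × AgreeOnValid v f f'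
    subtreeRun-deterministic r≈r' sub-zero sub-zero = refl , r≈r'
    subtreeRun-deterministic r≈r' (sub-return R a ex) (sub-return R' a' ex')
      with subtreeRun-deterministic r≈r' R R'
    ... | e≡e' , f≈f' = e≡e' , return-deterministic (agreeOnValid-bridge a f≈f' a') ex ex'
    subtreeRun-deterministic r≈r' (sub-return R a ex) (sub-escape R' a' esc')
      with subtreeRun-deterministic r≈r' R R'
    ... | _ , f≈f' = ⊥-elim (return-escape-exclusive (agreeOnValid-bridge a f≈f' a') ex esc')
    subtreeRun-deterministic r≈r' (sub-escape R a esc) (sub-return R' a' ex')
      with subtreeRun-deterministic r≈r' R R'
    ... | _ , f≈f' = ⊥-elim (return-escape-exclusive (agreeOnValid-sym (agreeOnValid-bridge a f≈f' a')) ex' esc)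
    subtreeRun-deterministic r≈r' (sub-escape R a esc) (sub-escape R' a' esc')
      with subtreeRun-deterministic r≈r' R R'
    ... | e≡e' , f≈f' = cong suc e≡e' , escape-deterministic (agreeOnValid-bridge a f≈f' a') esc esc'

  subtreeRun-prefix : ∀ {u r j m e f} → j ≤ m → SubtreeRun u r m e f →
                      ∃ λ e₀ → ∃ λ f₀ → e₀ ≤ e × SubtreeRun u r j e₀ f₀
  subtreeRun-prefix j≤m R with m≤n⇒m<n∨m≡n j≤m
  ... | inj₂ refl = _ , _ , ≤-refl , R
  ... | inj₁ j<m  = shorten j<m R
    where
      shorten : ∀ {j m e f u r} → j < m → SubtreeRun u r m e f →
                ∃ λ e₀ → ∃ λ f₀ → e₀ ≤ e × SubtreeRun u r j e₀ f₀
      shorten (s≤s j≤m) (sub-return R _ _) = subtreeRun-prefix j≤m R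
      shorten (s≤s j≤m) (sub-escape R _ _) with subtreeRun-prefix j≤m R
      ... | e₀ , f₀ , e₀≤e , R₀ = e₀ , f₀ , m≤n⇒m≤1+n e₀≤e , R₀

  module _ (r r' : Config) (L : List Addr) (agree-off-L : ∀ w → Valid b w → w ∉ L → r w ≡ r' w) where

    Δ : Addr → ℕ
    Δ = subtreeDiff r r' L

    rotorDiff≤Δ : ∀ {v} → Valid b v → ∣ r v - r' v ∣ ≤ Δ v
    rotorDiff≤Δ {v} valid with v ∈? L
    ... | yes v∈L = subtreeDiff-∈ r r' L v∈L
    ... | no v∉L  =
      ≤-trans (≤-reflexive (trans (cong (λ x → ∣ x - r' v ∣) (agree-off-L v valid v∉L)) (∣n-n∣≡0 (r' v)))) z≤n

    agree-below-L : ∀ {v} → WithinDepth L 0 v → AgreeOnValid v r r'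
    agree-below-L {v} within w valid v≼w = agree-off-L w valid λ w∈L →
      <⇒≱ (subst (length w <_) (+-identityʳ _) (within w w∈L v≼w)) (≼-length v≼w)

    escapes-≤ : ∀ h {v} → Valid b v → WithinDepth L h v → ∀ {m e e' f f'} →
                SubtreeRun v r m e f → SubtreeRun v r' m e' f' → e' ≤ e + Δ v
    escapes-≤ zero {v} valid within {e = e} R R' =
      subst (_≤ e + Δ v) (proj₁ (subtreeRun-deterministic valid (agree-below-L within) R R')) (m≤m+n e (Δ v))
    escapes-≤ (suc h) {v} valid within {m} {e} {e'} R R'
      with subtreeRun⇒childRuns R | subtreeRun⇒childRuns R'
    ... | P , d , m≡P+e | P' , d' , m≡P'+e' with P ≤? P' + Δ v
    ...   | yes few-returns = swap-≤ (trans (sym m≡P+e) m≡P'+e') few-returns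
    ...   | no many-returns = begin
          e'
        ≡⟨ total d' ⟨
          Σ< (b v) (escapes d')
        ≤⟨ Σ<-mono-≤ (b v) child-escapes-≤ ⟩
          Σ< (b v) (λ c → escapes d c + Δ (c ∷ v))
        ≡⟨ Σ<-distrib-+ (b v) _ _ ⟩
          Σ< (b v) (escapes d) + Σ< (b v) (λ c → Δ (c ∷ v))
        ≤⟨ +-mono-≤ (≤-reflexive (total d)) (subtreeDiff-children r r' L v (b v)) ⟩
          e + Δ v
        ∎
      where
        open ≤-Reasoning
        fewer-entries : ∀ c → c < b v → entries d' c ≤ entries d c
        fewer-entries c c<b = balance-≤ (balance d c c<b) (balance d' c c<b) (𝟙≤1 _)
          (≤-trans (𝟙-<-∣-∣ c (r v) (r' v)) (+-monoʳ-≤ _ (rotorDiff≤Δ valid))) (≰⇒> many-returns)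
        child-escapes-≤ : ∀ c → c < b v → escapes d' c ≤ escapes d c + Δ (c ∷ v)
        child-escapes-≤ c c<b with run d c c<b | run d' c c<b
        ... | _ , R-c , _ | _ , R'-c , _ with subtreeRun-prefix (fewer-entries c c<b) R-c
        ...   | e₀ , _ , e₀≤ , R₀ =
          ≤-trans (escapes-≤ h (valid , c<b) (within-child c within) R₀ R'-c) (+-monoˡ-≤ _ e₀≤)

  walk-after-root : ∀ r k → walk b r (suc k) ≡ walkFrom [] r k
  walk-after-root r k = iter-suc k (nothing , r)

  returns⇒return : ∀ {r r₂} → Returns b r r₂ → Return [] r r₂
  returns⇒return (zero , () , _)
  returns⇒return {r} (suc k , _ , at-root , earlier , final) = record
    { steps   = k
    ; arrives = trans (cong proj₁ (sym (walk-after-root r k))) at-root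
    ; first   = λ j j<k at → earlier (suc j) (s≤s z≤n) (s≤s j<k) (trans (cong proj₁ (walk-after-root r j)) at)
    ; leaves  = λ w → trans (cong (λ s → proj₂ s w) (sym (walk-after-root r k))) (final w)
    }

  escapes⇒escape : ∀ {r r₂} → Escapes b r r₂ → Escape [] r r₂
  escapes⇒escape {r} (never , settled-after) = record
    { avoids  = λ j at → never (suc j) (s≤s z≤n) (trans (cong proj₁ (walk-after-root r j)) at)
    ; settles = λ w → let K , settled = settled-after w in
        K , λ k K≤k → trans (cong (λ s → proj₂ s w) (sym (walk-after-root r k)))
                            (settled (suc k) (m≤n⇒m≤1+n K≤k))
    }

  run⇒subtreeRun : ∀ {r n e f} → Run b r n e f → SubtreeRun [] r n e f
  run⇒subtreeRun run-zero           = sub-zero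
  run⇒subtreeRun (run-return R ret) = sub-return (run⇒subtreeRun R) (λ _ _ → refl) (returns⇒return ret)
  run⇒subtreeRun (run-escape R esc) = sub-escape (run⇒subtreeRun R) (λ _ _ → refl) (escapes⇒escape esc)

  escapes-≤-diffSum : ∀ r r' L → (∀ v → Valid b v → v ∉ L → r v ≡ r' v) →
                      ∀ {n e e' f f'} → Run b r n e f → Run b r' n e' f' → e' ≤ e + diffSum r r' L
  escapes-≤-diffSum r r' L agree {e = e} {e'} R R' =
    subst (λ x → e' ≤ e + x) (subtreeDiff-root r r' L)
      (escapes-≤ r r' L agree (suc deepest) tt below-deepest (run⇒subtreeRun R) (run⇒subtreeRun R'))
    where
      deepest = length (argmax length [] L)
      below-deepest : WithinDepth L (suc deepest) []
      below-deepest w w∈L _ = s≤s (All.lookup (f[xs]≤f[argmax] [] L) w∈L)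

proposition12 : (b : Tree) → Infinite b
    → (r r' : Config) → IsRotorConfig b r → IsRotorConfig b r'
    → (L : List Addr) → Unique L → All (Valid b) L
    → (∀ v → Valid b v → v ∉ L → r v ≡ r' v)
    → ∀ n e e' f f' → Run b r n e f → Run b r' n e' f'
    → ∣ e - e' ∣ ≤ diffSum r r' L
proposition12 b _ r r' _ _ L _ _ agree n e e' f f' R R' =
  m≤n+o⇒n≤m+o⇒∣m-n∣≤o
    (subst (λ x → e ≤ e' + x) (diffSum-comm r' r L)
       (escapes-≤-diffSum b r' r L (λ v valid v∉L → sym (agree v valid v∉L)) R' R))
    (escapes-≤-diffSum b r r' L agree R R')
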